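{- For every $n\in\mathbb N_0$, $$\sum_{j=0}^{n+1}\binom{n+1}j (n+j+1)E_{n+j}(0)=0.$$
   Context: The Euler polynomials $E_n(a)$ are defined by $\frac{2e^{at}}{e^t+1}=\sum_{n=0}^\infty E_n(a)\frac{t^n}{n!}$; $\binom{N}{j}$ denotes the binomial coefficient. -}

module Defs where

open import Data.Nat as ℕ using (ℕ; zero; suc)
open import Data.Nat.Combinatorics using (_C_)
open import Data.Integer using (+_)
open import Data.Rational using (ℚ; _+_; _*_; _-_; ½; 0ℚ; 1ℚ; _/_)
open import Data.Fin using (Fin; toℕ)
open import Data.Vec using (Vec; []; _∷ʳ_; last; lookup)

ℕ→ℚ : ℕ → ℚ
ℕ→ℚ m = + m / 1

_^ℚ_ : ℚ → ℕ → ℚ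
a ^ℚ zero = 1ℚ
a ^ℚ suc m = a * (a ^ℚ m)

Σ< : (n : ℕ) → (ℕ → ℚ) → ℚ
Σ< zero f = 0ℚ
Σ< (suc n) f = Σ< n f + f n

ΣFin : (n : ℕ) → (Fin n → ℚ) → ℚ
ΣFin zero f = 0ℚ
ΣFin (suc n) f = f Fin.zero + ΣFin n (λ i → f (Fin.suc i))

-- Comparing coefficients of t^n/n! in  2 e^{at} = (e^t + 1) Σ E_k(a) t^k/k!
-- gives  2 a^n = Σ_{k=0}^{n} C(n,k) E_k(a) + E_n(a), i.e.
--   E_n(a) = a^n - ½ Σ_{k<n} C(n,k) E_k(a).
-- eulerVec a n = [E_0(a), …, E_{n-1}(a)]
eulerVec : ℚ → (n : ℕ) → Vec ℚ n
eulerVec a zero = []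
eulerVec a (suc n) =
  let es = eulerVec a n in
  es ∷ʳ ((a ^ℚ n) - ½ * ΣFin n (λ k → ℕ→ℚ (n C toℕ k) * lookup es k))

eulerE : ℕ → ℚ → ℚ
eulerE n a = last (eulerVec a (suc n))

-- E_k(x) is the polynomial solution of e(x + 1) + e(x) = 2x^k, and for a polynomial q with
-- Δ^(N+1) q = 0 the equation e(x + 1) + e(x) = 2q(x) is solved by e = Σ_{j≤N} (-½)^j Δ^j q
-- (the operator identity 2/(2 + Δ) = Σ_j (-Δ/2)^j).  So y^k ↦ E_k(0) extends linearly to q ↦ e(0).
-- The solution is unique among polynomials: a difference d of two solutions is antiperiodic,
-- d(x + 1) = -d(x), hence d = -½ Δd, and iterating Δ kills d.  If q(-1 - x) = -q(x), then
-- x ↦ -e(-x) solves the same equation, so e is odd and e(0) = 0.  The sum in the theorem is the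
-- image of q(y) = Σ_j C(n+1,j)(n+j+1) y^(n+j) = (n+1)(y(y+1))^n (2y+1), which is odd about -½.
module Submission where

open import Defs
open import Data.Nat using (ℕ; suc; _+_)
open import Data.Nat.Combinatorics using (_C_)
open import Data.Rational using (ℚ; _*_; 0ℚ)
open import Relation.Binary.PropositionalEquality using (_≡_)

open import Data.Nat as ℕ using (zero; _≤_; _<_; s≤s; _≤′_; ≤′-refl; ≤′-step)
import Data.Nat.Properties as ℕₚ
open import Data.Nat.Induction using (<-rec)
open import Data.Nat.Tactic.RingSolver using (solve-∀)
open import Data.Nat.Combinatorics using (nCn≡1; nC1≡n; nCk+nC[k+1]≡[n+1]C[k+1])
open import Data.Nat.Combinatorics.Specification using (k>n⇒nCk≡0)
open import Data.Nat.Coprimality using (1-coprimeTo) renaming (sym to coprime-sym)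
import Data.Integer as ℤ
import Data.Integer.Properties as ℤₚ
open import Data.Rational using (1ℚ; ½; -_; _-_; _/_) renaming (_+_ to _+ℚ_)
open import Data.Rational.Properties
  using ( normalize-coprime; +-identityˡ; +-identityʳ; +-assoc
        ; *-identityˡ; *-zeroˡ; *-zeroʳ; *-assoc; *-distribˡ-+; *-distribʳ-+)
open import Data.Rational.Solver using (module +-*-Solver)
open import Data.Fin using (Fin; toℕ; fromℕ; inject₁)
open import Data.Fin.Properties using (toℕ-fromℕ; toℕ-inject₁)
open import Data.Fin.Relation.Unary.Top using (view; ‵fromℕ; ‵inject₁)
open import Data.Vec using (Vec; []; _∷_; _∷ʳ_; lookup)
open import Data.Vec.Properties using (last-∷ʳ)
open import Relation.Binary.PropositionalEquality using (refl; sym; trans; cong; cong₂; module ≡-Reasoning)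
open ≡-Reasoning
open +-*-Solver using (solve; _:+_; _:*_; _:-_; :-_; con; _:=_)

Σ<-cong< : ∀ K {f g : ℕ → ℚ} → (∀ i → i < K → f i ≡ g i) → Σ< K f ≡ Σ< K g
Σ<-cong< zero    eq = refl
Σ<-cong< (suc K) eq =
  cong₂ _+ℚ_ (Σ<-cong< K (λ i i<K → eq i (ℕₚ.m<n⇒m<1+n i<K))) (eq K (ℕₚ.n<1+n K))

Σ<-cong : ∀ K {f g : ℕ → ℚ} → (∀ i → f i ≡ g i) → Σ< K f ≡ Σ< K g
Σ<-cong K eq = Σ<-cong< K (λ i _ → eq i)

Σ<-0 : ∀ K {f : ℕ → ℚ} → (∀ i → i < K → f i ≡ 0ℚ) → Σ< K f ≡ 0ℚ
Σ<-0 zero    eq = refl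
Σ<-0 (suc K) eq = cong₂ _+ℚ_ (Σ<-0 K (λ i i<K → eq i (ℕₚ.m<n⇒m<1+n i<K))) (eq K (ℕₚ.n<1+n K))

Σ<-+ : ∀ K (f g : ℕ → ℚ) → Σ< K (λ i → f i +ℚ g i) ≡ Σ< K f +ℚ Σ< K g
Σ<-+ zero    f g = refl
Σ<-+ (suc K) f g = trans (cong (_+ℚ (f K +ℚ g K)) (Σ<-+ K f g))
  (solve 4 (λ s t a b → (s :+ t) :+ (a :+ b) := (s :+ a) :+ (t :+ b)) refl
    (Σ< K f) (Σ< K g) (f K) (g K))

Σ<-*ˡ : ∀ K a (f : ℕ → ℚ) → Σ< K (λ i → a * f i) ≡ a * Σ< K f
Σ<-*ˡ zero    a f = sym (*-zeroʳ a)
Σ<-*ˡ (suc K) a f =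
  trans (cong (_+ℚ (a * f K)) (Σ<-*ˡ K a f)) (sym (*-distribˡ-+ a (Σ< K f) (f K)))

Σ<-head : ∀ K (f : ℕ → ℚ) → Σ< (suc K) f ≡ f 0 +ℚ Σ< K (λ i → f (suc i))
Σ<-head zero    f = trans (+-identityˡ (f 0)) (sym (+-identityʳ (f 0)))
Σ<-head (suc K) f = trans (cong (_+ℚ f (suc K)) (Σ<-head K f))
  (+-assoc (f 0) (Σ< K (λ i → f (suc i))) (f (suc K)))

Σ<-comm : ∀ A B (F : ℕ → ℕ → ℚ) →
  Σ< A (λ j → Σ< B (F j)) ≡ Σ< B (λ i → Σ< A (λ j → F j i))
Σ<-comm zero    B F = sym (Σ<-0 B (λ _ _ → refl))
Σ<-comm (suc A) B F = trans (cong (_+ℚ Σ< B (F A)) (Σ<-comm A B F))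
  (sym (Σ<-+ B (λ i → Σ< A (λ j → F j i)) (F A)))

Σ<-telescope : ∀ K (b : ℕ → ℚ) → Σ< K (λ j → b j - b (suc j)) ≡ b 0 - b K
Σ<-telescope zero    b = solve 1 (λ a → con 0ℚ := a :- a) refl (b 0)
Σ<-telescope (suc K) b = trans (cong (_+ℚ (b K - b (suc K))) (Σ<-telescope K b))
  (solve 3 (λ a c d → (a :- c) :+ (c :- d) := a :- d) refl (b 0) (b K) (b (suc K)))

ΣFin-toℕ : ∀ K {f : Fin K → ℚ} (g : ℕ → ℚ) → (∀ i → f i ≡ g (toℕ i)) → ΣFin K f ≡ Σ< K g
ΣFin-toℕ zero    g eq = refl
ΣFin-toℕ (suc K) g eq = trans
  (cong₂ _+ℚ_ (eq Fin.zero) (ΣFin-toℕ K (λ i → g (suc i)) (λ i → eq (Fin.suc i))))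
  (sym (Σ<-head K g))

-- Once ℕ→ℚ m is exposed as the normal form mkℚ (+ m) 0 _, the right side computes to (+ 1 ℤ.+ + m ℤ.* + 1) / 1.
ℕ→ℚ-suc : ∀ m → ℕ→ℚ (suc m) ≡ 1ℚ +ℚ ℕ→ℚ m
ℕ→ℚ-suc m rewrite normalize-coprime (coprime-sym (1-coprimeTo m)) =
  cong (λ z → (ℤ.+ 1 ℤ.+ z) / 1) (sym (ℤₚ.*-identityʳ (ℤ.+ m)))

ℕ→ℚ-+ : ∀ a b → ℕ→ℚ (a + b) ≡ ℕ→ℚ a +ℚ ℕ→ℚ b
ℕ→ℚ-+ zero    b = solve 1 (λ x → x := con 0ℚ :+ x) refl (ℕ→ℚ b)
ℕ→ℚ-+ (suc a) b = begin
  ℕ→ℚ (suc (a + b))           ≡⟨ ℕ→ℚ-suc (a + b) ⟩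
  1ℚ +ℚ ℕ→ℚ (a + b)           ≡⟨ cong (1ℚ +ℚ_) (ℕ→ℚ-+ a b) ⟩
  1ℚ +ℚ (ℕ→ℚ a +ℚ ℕ→ℚ b)      ≡⟨ sym (+-assoc 1ℚ (ℕ→ℚ a) (ℕ→ℚ b)) ⟩
  (1ℚ +ℚ ℕ→ℚ a) +ℚ ℕ→ℚ b      ≡⟨ cong (_+ℚ ℕ→ℚ b) (sym (ℕ→ℚ-suc a)) ⟩
  ℕ→ℚ (suc a) +ℚ ℕ→ℚ b        ∎

ℕ→ℚ-* : ∀ a b → ℕ→ℚ (a ℕ.* b) ≡ ℕ→ℚ a * ℕ→ℚ b
ℕ→ℚ-* zero    b = sym (*-zeroˡ (ℕ→ℚ b))
ℕ→ℚ-* (suc a) b = begin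
  ℕ→ℚ (b + a ℕ.* b)              ≡⟨ ℕ→ℚ-+ b (a ℕ.* b) ⟩
  ℕ→ℚ b +ℚ ℕ→ℚ (a ℕ.* b)         ≡⟨ cong (ℕ→ℚ b +ℚ_) (ℕ→ℚ-* a b) ⟩
  ℕ→ℚ b +ℚ ℕ→ℚ a * ℕ→ℚ b
    ≡⟨ solve 2 (λ x y → y :+ x :* y := (con 1ℚ :+ x) :* y) refl (ℕ→ℚ a) (ℕ→ℚ b) ⟩
  (1ℚ +ℚ ℕ→ℚ a) * ℕ→ℚ b          ≡⟨ cong (_* ℕ→ℚ b) (sym (ℕ→ℚ-suc a)) ⟩
  ℕ→ℚ (suc a) * ℕ→ℚ b            ∎

^ℚ-+ : ∀ x a b → x ^ℚ (a + b) ≡ x ^ℚ a * x ^ℚ b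
^ℚ-+ x zero    b = sym (*-identityˡ (x ^ℚ b))
^ℚ-+ x (suc a) b = trans (cong (x *_) (^ℚ-+ x a b)) (sym (*-assoc x (x ^ℚ a) (x ^ℚ b)))

^ℚ-distrib-* : ∀ x y n → (x * y) ^ℚ n ≡ x ^ℚ n * y ^ℚ n
^ℚ-distrib-* x y zero    = refl
^ℚ-distrib-* x y (suc n) = trans (cong ((x * y) *_) (^ℚ-distrib-* x y n))
  (solve 4 (λ x y p q → (x :* y) :* (p :* q) := (x :* p) :* (y :* q)) refl x y (x ^ℚ n) (y ^ℚ n))

[k+1]*[n+1]C[k+1]≡[n+1]*nCk : ∀ n k → suc k ℕ.* (suc n C suc k) ≡ suc n ℕ.* (n C k)
[k+1]*[n+1]C[k+1]≡[n+1]*nCk zero    zero    = refl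
[k+1]*[n+1]C[k+1]≡[n+1]*nCk zero    (suc k)
  rewrite k>n⇒nCk≡0 {1} {suc (suc k)} (s≤s (s≤s ℕ.z≤n)) | k>n⇒nCk≡0 {0} {suc k} (s≤s ℕ.z≤n)
  = ℕₚ.*-zeroʳ (suc (suc k))
[k+1]*[n+1]C[k+1]≡[n+1]*nCk (suc n) zero
  rewrite nC1≡n (suc (suc n)) = trans (ℕₚ.+-identityʳ (suc (suc n))) (sym (ℕₚ.*-identityʳ (suc (suc n))))
[k+1]*[n+1]C[k+1]≡[n+1]*nCk (suc n) (suc k) = begin
  suc (suc k) ℕ.* (suc (suc n) C suc (suc k))
    ≡⟨ cong (suc (suc k) ℕ.*_) (sym (nCk+nC[k+1]≡[n+1]C[k+1] (suc n) (suc k))) ⟩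
  suc (suc k) ℕ.* (a + b)
    ≡⟨ rearrange k a b ⟩
  a + (suc k ℕ.* a + suc (suc k) ℕ.* b)
    ≡⟨ cong₂ (λ s t → a + (s + t))
         ([k+1]*[n+1]C[k+1]≡[n+1]*nCk n k) ([k+1]*[n+1]C[k+1]≡[n+1]*nCk n (suc k)) ⟩
  a + (suc n ℕ.* (n C k) + suc n ℕ.* (n C suc k))
    ≡⟨ cong (a +_) (sym (ℕₚ.*-distribˡ-+ (suc n) (n C k) (n C suc k))) ⟩
  a + suc n ℕ.* (n C k + n C suc k)
    ≡⟨ cong (λ t → a + suc n ℕ.* t) (nCk+nC[k+1]≡[n+1]C[k+1] n k) ⟩
  a + suc n ℕ.* a ∎
  where
  a = suc n C suc k
  b = suc n C suc (suc k)
  rearrange : ∀ k a b → suc (suc k) ℕ.* (a + b) ≡ a + (suc k ℕ.* a + suc (suc k) ℕ.* b)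
  rearrange = solve-∀

binomial : ∀ k x → (x +ℚ 1ℚ) ^ℚ k ≡ Σ< (suc k) (λ i → ℕ→ℚ (k C i) * x ^ℚ i)
binomial zero    x = refl
binomial (suc k) x = begin
  (x +ℚ 1ℚ) * (x +ℚ 1ℚ) ^ℚ k
    ≡⟨ cong ((x +ℚ 1ℚ) *_) (binomial k x) ⟩
  (x +ℚ 1ℚ) * S
    ≡⟨ *-distribʳ-+ S x 1ℚ ⟩
  x * S +ℚ 1ℚ * S
    ≡⟨ cong₂ _+ℚ_ (sym (Σ<-*ˡ (suc k) x t)) (trans (*-identityˡ S) S≡1+S′) ⟩
  xS +ℚ (1ℚ +ℚ S′)
    ≡⟨ solve 2 (λ u v → u :+ (con 1ℚ :+ v) := con 1ℚ :+ (u :+ v)) refl xS S′ ⟩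
  1ℚ +ℚ (xS +ℚ S′)
    ≡⟨ cong (1ℚ +ℚ_) (sym (Σ<-+ (suc k) (λ i → x * t i) (λ i → t (suc i)))) ⟩
  1ℚ +ℚ Σ< (suc k) (λ i → x * t i +ℚ t (suc i))
    ≡⟨ cong (1ℚ +ℚ_) (Σ<-cong (suc k) pascal) ⟩
  1ℚ +ℚ Σ< (suc k) (λ i → ℕ→ℚ (suc k C suc i) * x ^ℚ suc i)
    ≡⟨ sym (Σ<-head (suc k) (λ i → ℕ→ℚ (suc k C i) * x ^ℚ i)) ⟩
  Σ< (suc (suc k)) (λ i → ℕ→ℚ (suc k C i) * x ^ℚ i) ∎
  where
  t : ℕ → ℚ
  t i = ℕ→ℚ (k C i) * x ^ℚ i
  S = Σ< (suc k) t
  S′ = Σ< (suc k) (λ i → t (suc i))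
  xS = Σ< (suc k) (λ i → x * t i)
  S≡1+S′ : S ≡ 1ℚ +ℚ S′
  S≡1+S′ = begin
    S                    ≡⟨ sym (+-identityʳ S) ⟩
    S +ℚ 0ℚ              ≡⟨ cong (S +ℚ_) (sym (*-zeroˡ (x ^ℚ suc k))) ⟩
    S +ℚ 0ℚ * x ^ℚ suc k
      ≡⟨ cong (λ c → S +ℚ ℕ→ℚ c * x ^ℚ suc k) (sym (k>n⇒nCk≡0 (ℕₚ.n<1+n k))) ⟩
    Σ< (suc (suc k)) t   ≡⟨ Σ<-head (suc k) t ⟩
    1ℚ +ℚ S′             ∎
  pascal : ∀ i → x * t i +ℚ t (suc i) ≡ ℕ→ℚ (suc k C suc i) * x ^ℚ suc i
  pascal i = begin
    x * (ℕ→ℚ (k C i) * x ^ℚ i) +ℚ ℕ→ℚ (k C suc i) * (x * x ^ℚ i)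
      ≡⟨ solve 4 (λ x a b p → x :* (a :* p) :+ b :* (x :* p) := (a :+ b) :* (x :* p)) refl
           x (ℕ→ℚ (k C i)) (ℕ→ℚ (k C suc i)) (x ^ℚ i) ⟩
    (ℕ→ℚ (k C i) +ℚ ℕ→ℚ (k C suc i)) * (x * x ^ℚ i)
      ≡⟨ cong (_* (x * x ^ℚ i))
           (trans (sym (ℕ→ℚ-+ (k C i) (k C suc i))) (cong ℕ→ℚ (nCk+nC[k+1]≡[n+1]C[k+1] k i))) ⟩
    ℕ→ℚ (suc k C suc i) * (x * x ^ℚ i) ∎

binomial-derivative : ∀ m y →
  Σ< (suc (suc m)) (λ j → ℕ→ℚ j * (ℕ→ℚ (suc m C j) * y ^ℚ j))
    ≡ ℕ→ℚ (suc m) * (y * (y +ℚ 1ℚ) ^ℚ m)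
binomial-derivative m y = begin
  Σ< (suc (suc m)) (λ j → ℕ→ℚ j * (ℕ→ℚ (suc m C j) * y ^ℚ j))
    ≡⟨ Σ<-head (suc m) (λ j → ℕ→ℚ j * (ℕ→ℚ (suc m C j) * y ^ℚ j)) ⟩
  0ℚ +ℚ Σ< (suc m) (λ i → ℕ→ℚ (suc i) * (ℕ→ℚ (suc m C suc i) * y ^ℚ suc i))
    ≡⟨ cong (0ℚ +ℚ_) (Σ<-cong (suc m) absorb) ⟩
  0ℚ +ℚ Σ< (suc m) (λ i → ℕ→ℚ (suc m) * (y * (ℕ→ℚ (m C i) * y ^ℚ i)))
    ≡⟨ +-identityˡ _ ⟩
  Σ< (suc m) (λ i → ℕ→ℚ (suc m) * (y * (ℕ→ℚ (m C i) * y ^ℚ i)))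
    ≡⟨ Σ<-*ˡ (suc m) (ℕ→ℚ (suc m)) _ ⟩
  ℕ→ℚ (suc m) * Σ< (suc m) (λ i → y * (ℕ→ℚ (m C i) * y ^ℚ i))
    ≡⟨ cong (ℕ→ℚ (suc m) *_) (trans (Σ<-*ˡ (suc m) y _) (cong (y *_) (sym (binomial m y)))) ⟩
  ℕ→ℚ (suc m) * (y * (y +ℚ 1ℚ) ^ℚ m) ∎
  where
  absorb : ∀ i → ℕ→ℚ (suc i) * (ℕ→ℚ (suc m C suc i) * y ^ℚ suc i)
               ≡ ℕ→ℚ (suc m) * (y * (ℕ→ℚ (m C i) * y ^ℚ i))
  absorb i = begin
    ℕ→ℚ (suc i) * (ℕ→ℚ (suc m C suc i) * (y * y ^ℚ i))
      ≡⟨ sym (*-assoc (ℕ→ℚ (suc i)) _ _) ⟩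
    (ℕ→ℚ (suc i) * ℕ→ℚ (suc m C suc i)) * (y * y ^ℚ i)
      ≡⟨ cong (_* (y * y ^ℚ i)) (trans (sym (ℕ→ℚ-* (suc i) (suc m C suc i)))
           (trans (cong ℕ→ℚ ([k+1]*[n+1]C[k+1]≡[n+1]*nCk m i)) (ℕ→ℚ-* (suc m) (m C i)))) ⟩
    (ℕ→ℚ (suc m) * ℕ→ℚ (m C i)) * (y * y ^ℚ i)
      ≡⟨ solve 4 (λ s c y p → (s :* c) :* (y :* p) := s :* (y :* (c :* p))) refl
           (ℕ→ℚ (suc m)) (ℕ→ℚ (m C i)) y (y ^ℚ i) ⟩
    ℕ→ℚ (suc m) * (y * (ℕ→ℚ (m C i) * y ^ℚ i)) ∎

Δ : (ℚ → ℚ) → ℚ → ℚ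
Δ f x = f (x +ℚ 1ℚ) - f x

Δ^ : ℕ → (ℚ → ℚ) → ℚ → ℚ
Δ^ zero    f = f
Δ^ (suc m) f = Δ (Δ^ m f)

Δ^-vanishes : ℕ → (ℚ → ℚ) → Set
Δ^-vanishes m f = ∀ x → Δ^ m f x ≡ 0ℚ

Δ^-cong : ∀ m {f g : ℚ → ℚ} → (∀ x → f x ≡ g x) → ∀ x → Δ^ m f x ≡ Δ^ m g x
Δ^-cong zero    eq x = eq x
Δ^-cong (suc m) eq x = cong₂ _-_ (Δ^-cong m eq (x +ℚ 1ℚ)) (Δ^-cong m eq x)

Δ^-+ : ∀ m (f g : ℚ → ℚ) x → Δ^ m (λ y → f y +ℚ g y) x ≡ Δ^ m f x +ℚ Δ^ m g x
Δ^-+ zero    f g x = refl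
Δ^-+ (suc m) f g x = trans (cong₂ _-_ (Δ^-+ m f g (x +ℚ 1ℚ)) (Δ^-+ m f g x))
  (solve 4 (λ a b c d → (a :+ b) :- (c :+ d) := (a :- c) :+ (b :- d)) refl
    (Δ^ m f (x +ℚ 1ℚ)) (Δ^ m g (x +ℚ 1ℚ)) (Δ^ m f x) (Δ^ m g x))

Δ^-*ˡ : ∀ m a (f : ℚ → ℚ) x → Δ^ m (λ y → a * f y) x ≡ a * Δ^ m f x
Δ^-*ˡ zero    a f x = refl
Δ^-*ˡ (suc m) a f x = trans (cong₂ _-_ (Δ^-*ˡ m a f (x +ℚ 1ℚ)) (Δ^-*ˡ m a f x))
  (solve 3 (λ a b c → a :* b :- a :* c := a :* (b :- c)) refl a (Δ^ m f (x +ℚ 1ℚ)) (Δ^ m f x))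

Δ^-Σ< : ∀ m K (F : ℕ → ℚ → ℚ) x →
  Δ^ m (λ y → Σ< K (λ j → F j y)) x ≡ Σ< K (λ j → Δ^ m (F j) x)
Δ^-Σ< m zero    F x = Δ^-const0 m x
  where
  Δ^-const0 : ∀ m x → Δ^ m (λ _ → 0ℚ) x ≡ 0ℚ
  Δ^-const0 zero    x = refl
  Δ^-const0 (suc m) x = cong₂ _-_ (Δ^-const0 m (x +ℚ 1ℚ)) (Δ^-const0 m x)
Δ^-Σ< m (suc K) F x = trans (Δ^-+ m (λ y → Σ< K (λ j → F j y)) (F K) x)
  (cong (_+ℚ Δ^ m (F K) x) (Δ^-Σ< m K F x))

Δ^-Δ : ∀ m f x → Δ^ m (Δ f) x ≡ Δ^ (suc m) f x
Δ^-Δ zero    f x = refl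
Δ^-Δ (suc m) f x = cong₂ _-_ (Δ^-Δ m f (x +ℚ 1ℚ)) (Δ^-Δ m f x)

Δ^-Δ^ : ∀ m j f x → Δ^ m (Δ^ j f) x ≡ Δ^ (m + j) f x
Δ^-Δ^ zero    j f x = refl
Δ^-Δ^ (suc m) j f x = cong₂ _-_ (Δ^-Δ^ m j f (x +ℚ 1ℚ)) (Δ^-Δ^ m j f x)

Δ^-shift : ∀ m f x → Δ^ m (λ y → f (y +ℚ 1ℚ)) x ≡ Δ^ m f (x +ℚ 1ℚ)
Δ^-shift zero    f x = refl
Δ^-shift (suc m) f x = cong₂ _-_ (Δ^-shift m f (x +ℚ 1ℚ)) (Δ^-shift m f x)

Δ^-vanishes-≤ : ∀ {m m′ f} → m ≤ m′ → Δ^-vanishes m f → Δ^-vanishes m′ f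
Δ^-vanishes-≤ m≤m′ = go (ℕₚ.≤⇒≤′ m≤m′)
  where
  go : ∀ {m m′ f} → m ≤′ m′ → Δ^-vanishes m f → Δ^-vanishes m′ f
  go ≤′-refl        v = v
  go (≤′-step m≤′n) v x = cong₂ _-_ (go m≤′n v (x +ℚ 1ℚ)) (go m≤′n v x)

Δ^-vanishes-+ : ∀ m {f g} → Δ^-vanishes m f → Δ^-vanishes m g → Δ^-vanishes m (λ y → f y +ℚ g y)
Δ^-vanishes-+ m {f} {g} vf vg x = trans (Δ^-+ m f g x) (cong₂ _+ℚ_ (vf x) (vg x))

Δ^-vanishes-*ˡ : ∀ m a {f} → Δ^-vanishes m f → Δ^-vanishes m (λ y → a * f y)
Δ^-vanishes-*ˡ m a {f} v x = trans (Δ^-*ˡ m a f x) (trans (cong (a *_) (v x)) (*-zeroʳ a))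

Δ^-vanishes-Σ< : ∀ m K {F : ℕ → ℚ → ℚ} → (∀ j → j < K → Δ^-vanishes m (F j)) →
  Δ^-vanishes m (λ y → Σ< K (λ j → F j y))
Δ^-vanishes-Σ< m K {F} v x = trans (Δ^-Σ< m K F x) (Σ<-0 K (λ j j<K → v j j<K x))

Δ^-vanishes-Δ^ : ∀ m j {f} → Δ^-vanishes m f → Δ^-vanishes m (Δ^ j f)
Δ^-vanishes-Δ^ m j {f} v x = trans (Δ^-Δ^ m j f x) (Δ^-vanishes-≤ (ℕₚ.m≤m+n m j) v x)

Δ-^ℚ : ∀ k x → Δ (_^ℚ k) x ≡ Σ< k (λ i → ℕ→ℚ (k C i) * x ^ℚ i)
Δ-^ℚ k x = begin
  (x +ℚ 1ℚ) ^ℚ k - x ^ℚ k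
    ≡⟨ cong (_- x ^ℚ k) (binomial k x) ⟩
  S +ℚ ℕ→ℚ (k C k) * x ^ℚ k - x ^ℚ k
    ≡⟨ cong (λ c → S +ℚ ℕ→ℚ c * x ^ℚ k - x ^ℚ k) (nCn≡1 k) ⟩
  S +ℚ 1ℚ * x ^ℚ k - x ^ℚ k
    ≡⟨ solve 2 (λ s p → s :+ con 1ℚ :* p :- p := s) refl S (x ^ℚ k) ⟩
  S ∎
  where S = Σ< k (λ i → ℕ→ℚ (k C i) * x ^ℚ i)

^ℚ-vanishes : ∀ k → Δ^-vanishes (suc k) (_^ℚ k)
^ℚ-vanishes = <-rec (λ k → Δ^-vanishes (suc k) (_^ℚ k)) λ k ih x → begin
  Δ^ (suc k) (_^ℚ k) x                              ≡⟨ sym (Δ^-Δ k (_^ℚ k) x) ⟩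
  Δ^ k (Δ (_^ℚ k)) x                                ≡⟨ Δ^-cong k (Δ-^ℚ k) x ⟩
  Δ^ k (λ y → Σ< k (λ i → ℕ→ℚ (k C i) * y ^ℚ i)) x
    ≡⟨ Δ^-vanishes-Σ< k k
         (λ i i<k → Δ^-vanishes-*ˡ k (ℕ→ℚ (k C i)) (Δ^-vanishes-≤ i<k (ih i<k))) x ⟩
  0ℚ                                                ∎

Antiperiodic : (ℚ → ℚ) → Set
Antiperiodic d = ∀ x → d (x +ℚ 1ℚ) ≡ - d x

Δ-antiperiodic : ∀ {d} → Antiperiodic d → Antiperiodic (Δ d)
Δ-antiperiodic {d} anti x = begin
  d ((x +ℚ 1ℚ) +ℚ 1ℚ) - d (x +ℚ 1ℚ)   ≡⟨ cong (_- d (x +ℚ 1ℚ)) (anti (x +ℚ 1ℚ)) ⟩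
  - d (x +ℚ 1ℚ) - d (x +ℚ 1ℚ)         ≡⟨ cong (λ u → - u - u) (anti x) ⟩
  - (- d x) - (- d x)                 ≡⟨ solve 1 (λ v → :- (:- v) :- (:- v) := :- ((:- v) :- v)) refl (d x) ⟩
  - (- d x - d x)                     ≡⟨ cong (λ u → - (u - d x)) (sym (anti x)) ⟩
  - (d (x +ℚ 1ℚ) - d x)               ∎

antiperiodic-vanishes : ∀ m {d} → Antiperiodic d → Δ^-vanishes m d → ∀ x → d x ≡ 0ℚ
antiperiodic-vanishes zero        anti v = v
antiperiodic-vanishes (suc m) {d} anti v x = begin
  d x
    ≡⟨ solve 1 (λ v → v := con (- ½) :* ((:- v) :- v)) refl (d x) ⟩
  (- ½) * (- d x - d x)
    ≡⟨ cong (λ u → (- ½) * (u - d x)) (sym (anti x)) ⟩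
  (- ½) * Δ d x
    ≡⟨ cong ((- ½) *_) (antiperiodic-vanishes m (Δ-antiperiodic anti) Δd-vanishes x) ⟩
  (- ½) * 0ℚ
    ≡⟨ *-zeroʳ (- ½) ⟩
  0ℚ ∎
  where
  Δd-vanishes : Δ^-vanishes m (Δ d)
  Δd-vanishes y = trans (Δ^-Δ m d y) (v y)

Δ-reflect : ∀ a g y → Δ (λ z → g (a - z)) y ≡ (- 1ℚ) * Δ g ((a - 1ℚ) - y)
Δ-reflect a g y = begin
  g (a - (y +ℚ 1ℚ)) - g (a - y)
    ≡⟨ cong₂ (λ s t → g s - g t)
         (solve 2 (λ a y → a :- (y :+ con 1ℚ) := (a :- con 1ℚ) :- y) refl a y)
         (solve 2 (λ a y → a :- y := ((a :- con 1ℚ) :- y) :+ con 1ℚ) refl a y) ⟩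
  g w - g (w +ℚ 1ℚ)
    ≡⟨ solve 2 (λ u v → u :- v := con (- 1ℚ) :* (v :- u)) refl (g w) (g (w +ℚ 1ℚ)) ⟩
  (- 1ℚ) * Δ g w ∎
  where w = (a - 1ℚ) - y

reflect-vanishes : ∀ m a {g} → Δ^-vanishes m g → Δ^-vanishes m (λ y → g (a - y))
reflect-vanishes zero    a     v x = v (a - x)
reflect-vanishes (suc m) a {g} v x = begin
  Δ^ (suc m) (λ y → g (a - y)) x
    ≡⟨ sym (Δ^-Δ m _ x) ⟩
  Δ^ m (Δ (λ y → g (a - y))) x
    ≡⟨ Δ^-cong m (Δ-reflect a g) x ⟩
  Δ^ m (λ y → (- 1ℚ) * Δ g ((a - 1ℚ) - y)) x
    ≡⟨ Δ^-vanishes-*ˡ m (- 1ℚ) (reflect-vanishes m (a - 1ℚ) Δg-vanishes) x ⟩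
  0ℚ ∎
  where
  Δg-vanishes : Δ^-vanishes m (Δ g)
  Δg-vanishes y = trans (Δ^-Δ m g y) (v y)

euler : ℕ → (ℚ → ℚ) → ℚ → ℚ
euler N q x = Σ< (suc N) (λ j → (- ½) ^ℚ j * Δ^ j q x)

euler-cong : ∀ N {f g} → (∀ y → f y ≡ g y) → ∀ x → euler N f x ≡ euler N g x
euler-cong N eq x = Σ<-cong (suc N) (λ j → cong ((- ½) ^ℚ j *_) (Δ^-cong j eq x))

euler-*ˡ : ∀ N a f x → euler N (λ y → a * f y) x ≡ a * euler N f x
euler-*ˡ N a f x = trans
  (Σ<-cong (suc N) (λ j → trans (cong ((- ½) ^ℚ j *_) (Δ^-*ˡ j a f x))
    (solve 3 (λ c a d → c :* (a :* d) := a :* (c :* d)) refl ((- ½) ^ℚ j) a (Δ^ j f x))))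
  (Σ<-*ˡ (suc N) a (λ j → (- ½) ^ℚ j * Δ^ j f x))

euler-Σ< : ∀ N K (F : ℕ → ℚ → ℚ) x →
  euler N (λ y → Σ< K (λ i → F i y)) x ≡ Σ< K (λ i → euler N (F i) x)
euler-Σ< N K F x = trans
  (Σ<-cong (suc N) (λ j → trans (cong ((- ½) ^ℚ j *_) (Δ^-Σ< j K F x))
    (sym (Σ<-*ˡ K ((- ½) ^ℚ j) (λ i → Δ^ j (F i) x)))))
  (Σ<-comm (suc N) K (λ j i → (- ½) ^ℚ j * Δ^ j (F i) x))

euler-shift : ∀ N f x → euler N (λ y → f (y +ℚ 1ℚ)) x ≡ euler N f (x +ℚ 1ℚ)
euler-shift N f x = Σ<-cong (suc N) (λ j → cong ((- ½) ^ℚ j *_) (Δ^-shift j f x))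

euler-vanishes : ∀ N {q} → Δ^-vanishes (suc N) q → Δ^-vanishes (suc N) (euler N q)
euler-vanishes N v = Δ^-vanishes-Σ< (suc N) (suc N)
  (λ j _ → Δ^-vanishes-*ˡ (suc N) ((- ½) ^ℚ j) (Δ^-vanishes-Δ^ (suc N) j v))

-- Termwise (-½)^j (Δ^j q(x + 1) + Δ^j q(x)) = 2(b j - b (j + 1)), which telescopes.
euler-equation : ∀ N {q} → Δ^-vanishes (suc N) q → ∀ x →
  euler N q (x +ℚ 1ℚ) +ℚ euler N q x ≡ q x +ℚ q x
euler-equation N {q} v x = begin
  euler N q (x +ℚ 1ℚ) +ℚ euler N q x
    ≡⟨ sym (Σ<-+ (suc N) (λ j → (- ½) ^ℚ j * Δ^ j q (x +ℚ 1ℚ)) b) ⟩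
  Σ< (suc N) (λ j → (- ½) ^ℚ j * Δ^ j q (x +ℚ 1ℚ) +ℚ b j)
    ≡⟨ Σ<-cong (suc N) (λ j → double-step ((- ½) ^ℚ j) (Δ^ j q (x +ℚ 1ℚ)) (Δ^ j q x)) ⟩
  Σ< (suc N) (λ j → (b j - b (suc j)) +ℚ (b j - b (suc j)))
    ≡⟨ Σ<-+ (suc N) (λ j → b j - b (suc j)) (λ j → b j - b (suc j)) ⟩
  Σ< (suc N) (λ j → b j - b (suc j)) +ℚ Σ< (suc N) (λ j → b j - b (suc j))
    ≡⟨ cong (λ s → s +ℚ s) (Σ<-telescope (suc N) b) ⟩
  (b 0 - b (suc N)) +ℚ (b 0 - b (suc N))
    ≡⟨ cong (λ s → s +ℚ s) b0-bN≡q ⟩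
  q x +ℚ q x ∎
  where
  b : ℕ → ℚ
  b j = (- ½) ^ℚ j * Δ^ j q x
  double-step : ∀ c d a →
    c * d +ℚ c * a ≡ (c * a - ((- ½) * c) * (d - a)) +ℚ (c * a - ((- ½) * c) * (d - a))
  double-step = solve 3 (λ c d a → c :* d :+ c :* a
    := (c :* a :- (con (- ½) :* c) :* (d :- a)) :+ (c :* a :- (con (- ½) :* c) :* (d :- a))) refl
  b0-bN≡q : b 0 - b (suc N) ≡ q x
  b0-bN≡q = begin
    1ℚ * q x - c * Δ^ (suc N) q x
      ≡⟨ cong₂ _-_ (*-identityˡ (q x)) (trans (cong (c *_) (v x)) (*-zeroʳ c)) ⟩
    q x - 0ℚ
      ≡⟨ +-identityʳ (q x) ⟩
    q x ∎
    where c = (- ½) ^ℚ suc N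

euler-odd : ∀ N {q} → Δ^-vanishes (suc N) q → (∀ x → q (- 1ℚ - x) ≡ - q x) → euler N q 0ℚ ≡ 0ℚ
euler-odd N {q} v odd = begin
  e 0ℚ                   ≡⟨ solve 1 (λ u → u := con ½ :* (u :+ u)) refl (e 0ℚ) ⟩
  ½ * d 0ℚ               ≡⟨ cong (½ *_) (antiperiodic-vanishes (suc N) d-antiperiodic d-vanishes 0ℚ) ⟩
  ½ * 0ℚ                 ≡⟨ *-zeroʳ ½ ⟩
  0ℚ                     ∎
  where
  e = euler N q
  d : ℚ → ℚ
  d x = e x +ℚ e (0ℚ - x)
  d-vanishes : Δ^-vanishes (suc N) d
  d-vanishes = Δ^-vanishes-+ (suc N) (euler-vanishes N v) (reflect-vanishes (suc N) 0ℚ (euler-vanishes N v))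
  d-antiperiodic : Antiperiodic d
  d-antiperiodic x = begin
    e (x +ℚ 1ℚ) +ℚ e w
      ≡⟨ solve 4 (λ a b c f → a :+ b := ((a :+ c) :+ (f :+ b)) :- (c :+ f)) refl
           (e (x +ℚ 1ℚ)) (e w) (e x) (e (0ℚ - x)) ⟩
    ((e (x +ℚ 1ℚ) +ℚ e x) +ℚ (e (0ℚ - x) +ℚ e w)) - d x
      ≡⟨ cong₂ (λ s t → (s +ℚ t) - d x) (euler-equation N v x)
           (trans (cong (λ z → e z +ℚ e w) w+1≡-x) (euler-equation N v w)) ⟩
    ((q x +ℚ q x) +ℚ (q w +ℚ q w)) - d x
      ≡⟨ cong (λ s → ((q x +ℚ q x) +ℚ (s +ℚ s)) - d x) (trans (cong q w≡-1-x) (odd x)) ⟩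
    ((q x +ℚ q x) +ℚ (- q x +ℚ - q x)) - d x
      ≡⟨ solve 2 (λ a u → ((a :+ a) :+ (:- a :+ :- a)) :- u := :- u) refl (q x) (d x) ⟩
    - d x ∎
    where
    w = 0ℚ - (x +ℚ 1ℚ)
    w+1≡-x : 0ℚ - x ≡ w +ℚ 1ℚ
    w+1≡-x = solve 1 (λ x → con 0ℚ :- x := (con 0ℚ :- (x :+ con 1ℚ)) :+ con 1ℚ) refl x
    w≡-1-x : w ≡ - 1ℚ - x
    w≡-1-x = solve 1 (λ x → con 0ℚ :- (x :+ con 1ℚ) := con (- 1ℚ) :- x) refl x

euler-^ℚ-recurrence : ∀ N k → k ≤ N →
  euler N (_^ℚ k) 0ℚ ≡ 0ℚ ^ℚ k - ½ * Σ< k (λ i → ℕ→ℚ (k C i) * euler N (_^ℚ i) 0ℚ)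
euler-^ℚ-recurrence N k k≤N = begin
  A
    ≡⟨ solve 2 (λ a x → a := con ½ :* ((x :+ a) :+ a) :- con ½ :* x) refl A X ⟩
  ½ * ((X +ℚ A) +ℚ A) - ½ * X
    ≡⟨ cong (λ s → ½ * (s +ℚ A) - ½ * X) (sym shifted) ⟩
  ½ * (e (0ℚ +ℚ 1ℚ) +ℚ A) - ½ * X
    ≡⟨ cong (λ s → ½ * s - ½ * X) (euler-equation N vanishes 0ℚ) ⟩
  ½ * (z +ℚ z) - ½ * X
    ≡⟨ solve 2 (λ z x → con ½ :* (z :+ z) :- con ½ :* x := z :- con ½ :* x) refl z X ⟩
  z - ½ * X ∎
  where
  e = euler N (_^ℚ k)
  A = e 0ℚ
  z = 0ℚ ^ℚ k
  X = Σ< k (λ i → ℕ→ℚ (k C i) * euler N (_^ℚ i) 0ℚ)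
  vanishes : Δ^-vanishes (suc N) (_^ℚ k)
  vanishes = Δ^-vanishes-≤ (s≤s k≤N) (^ℚ-vanishes k)
  shifted : e (0ℚ +ℚ 1ℚ) ≡ X +ℚ A
  shifted = begin
    e (0ℚ +ℚ 1ℚ)
      ≡⟨ sym (euler-shift N (_^ℚ k) 0ℚ) ⟩
    euler N (λ y → (y +ℚ 1ℚ) ^ℚ k) 0ℚ
      ≡⟨ euler-cong N (binomial k) 0ℚ ⟩
    euler N (λ y → Σ< (suc k) (λ i → ℕ→ℚ (k C i) * y ^ℚ i)) 0ℚ
      ≡⟨ euler-Σ< N (suc k) (λ i y → ℕ→ℚ (k C i) * y ^ℚ i) 0ℚ ⟩
    Σ< (suc k) (λ i → euler N (λ y → ℕ→ℚ (k C i) * y ^ℚ i) 0ℚ)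
      ≡⟨ Σ<-cong (suc k) (λ i → euler-*ˡ N (ℕ→ℚ (k C i)) (_^ℚ i) 0ℚ) ⟩
    X +ℚ ℕ→ℚ (k C k) * A
      ≡⟨ cong (λ c → X +ℚ ℕ→ℚ c * A) (nCn≡1 k) ⟩
    X +ℚ 1ℚ * A
      ≡⟨ cong (X +ℚ_) (*-identityˡ A) ⟩
    X +ℚ A ∎

lookup-∷ʳ-fromℕ : ∀ {A : Set} {m} (xs : Vec A m) x → lookup (xs ∷ʳ x) (fromℕ m) ≡ x
lookup-∷ʳ-fromℕ []       x = refl
lookup-∷ʳ-fromℕ (_ ∷ xs) x = lookup-∷ʳ-fromℕ xs x

lookup-∷ʳ-inject₁ : ∀ {A : Set} {m} (xs : Vec A m) x i → lookup (xs ∷ʳ x) (inject₁ i) ≡ lookup xs i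
lookup-∷ʳ-inject₁ (_ ∷ xs) x Fin.zero    = refl
lookup-∷ʳ-inject₁ (_ ∷ xs) x (Fin.suc i) = lookup-∷ʳ-inject₁ xs x i

lookup-eulerVec : ∀ a m (j : Fin m) → lookup (eulerVec a m) j ≡ eulerE (toℕ j) a
lookup-eulerVec a (suc m) j with view j
... | ‵fromℕ = begin
  lookup (eulerVec a m ∷ʳ new) (fromℕ m)   ≡⟨ lookup-∷ʳ-fromℕ (eulerVec a m) new ⟩
  new                                      ≡⟨ sym (last-∷ʳ new (eulerVec a m)) ⟩
  eulerE m a                               ≡⟨ cong (λ k → eulerE k a) (sym (toℕ-fromℕ m)) ⟩
  eulerE (toℕ (fromℕ m)) a                 ∎
  where new = a ^ℚ m - ½ * ΣFin m (λ k → ℕ→ℚ (m C toℕ k) * lookup (eulerVec a m) k)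
... | ‵inject₁ i = begin
  lookup (eulerVec a (suc m)) (inject₁ i)  ≡⟨ lookup-∷ʳ-inject₁ (eulerVec a m) _ i ⟩
  lookup (eulerVec a m) i                  ≡⟨ lookup-eulerVec a m i ⟩
  eulerE (toℕ i) a                         ≡⟨ cong (λ k → eulerE k a) (sym (toℕ-inject₁ i)) ⟩
  eulerE (toℕ (inject₁ i)) a               ∎

eulerE-recurrence : ∀ k a → eulerE k a ≡ a ^ℚ k - ½ * Σ< k (λ i → ℕ→ℚ (k C i) * eulerE i a)
eulerE-recurrence k a = trans (last-∷ʳ _ (eulerVec a k))
  (cong (λ s → a ^ℚ k - ½ * s)
    (ΣFin-toℕ k (λ i → ℕ→ℚ (k C i) * eulerE i a)
      (λ j → cong (ℕ→ℚ (k C toℕ j) *_) (lookup-eulerVec a k j))))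

euler-^ℚ : ∀ N k → k ≤ N → euler N (_^ℚ k) 0ℚ ≡ eulerE k 0ℚ
euler-^ℚ N = <-rec (λ k → k ≤ N → euler N (_^ℚ k) 0ℚ ≡ eulerE k 0ℚ) λ k ih k≤N → begin
  euler N (_^ℚ k) 0ℚ
    ≡⟨ euler-^ℚ-recurrence N k k≤N ⟩
  0ℚ ^ℚ k - ½ * Σ< k (λ i → ℕ→ℚ (k C i) * euler N (_^ℚ i) 0ℚ)
    ≡⟨ cong (λ s → 0ℚ ^ℚ k - ½ * s)
         (Σ<-cong< k (λ i i<k →
           cong (ℕ→ℚ (k C i) *_) (ih i<k (ℕₚ.<⇒≤ (ℕₚ.<-≤-trans i<k k≤N))))) ⟩
  0ℚ ^ℚ k - ½ * Σ< k (λ i → ℕ→ℚ (k C i) * eulerE i 0ℚ)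
    ≡⟨ sym (eulerE-recurrence k 0ℚ) ⟩
  eulerE k 0ℚ ∎

-- d/dy (y(y+1))^(n+1), expanded so that y^k ↦ E_k(0) turns it into the sum of the theorem.
F : ℕ → ℚ → ℚ
F n y = Σ< (suc (suc n)) (λ j → ℕ→ℚ (suc n C j) * (ℕ→ℚ (n + j + 1) * y ^ℚ (n + j)))

F-closed : ∀ n y → F n y ≡ ℕ→ℚ (suc n) * ((y * (y +ℚ 1ℚ)) ^ℚ n * (y +ℚ (y +ℚ 1ℚ)))
F-closed n y = begin
  F n y
    ≡⟨ Σ<-cong K split ⟩
  Σ< K (λ j → Y * (s * t j +ℚ ℕ→ℚ j * t j))
    ≡⟨ Σ<-*ˡ K Y _ ⟩
  Y * Σ< K (λ j → s * t j +ℚ ℕ→ℚ j * t j)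
    ≡⟨ cong (Y *_) (Σ<-+ K (λ j → s * t j) (λ j → ℕ→ℚ j * t j)) ⟩
  Y * (Σ< K (λ j → s * t j) +ℚ Σ< K (λ j → ℕ→ℚ j * t j))
    ≡⟨ cong (λ u → Y * (u +ℚ Σ< K (λ j → ℕ→ℚ j * t j)))
         (trans (Σ<-*ˡ K s t) (cong (s *_) (sym (binomial (suc n) y)))) ⟩
  Y * (s * ((y +ℚ 1ℚ) * Z) +ℚ Σ< K (λ j → ℕ→ℚ j * t j))
    ≡⟨ cong (λ u → Y * (s * ((y +ℚ 1ℚ) * Z) +ℚ u)) (binomial-derivative n y) ⟩
  Y * (s * ((y +ℚ 1ℚ) * Z) +ℚ s * (y * Z))
    ≡⟨ solve 4 (λ Y s y Z → Y :* (s :* ((y :+ con 1ℚ) :* Z) :+ s :* (y :* Z))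
                         := s :* ((Y :* Z) :* (y :+ (y :+ con 1ℚ)))) refl Y s y Z ⟩
  s * ((Y * Z) * (y +ℚ (y +ℚ 1ℚ)))
    ≡⟨ cong (λ u → s * (u * (y +ℚ (y +ℚ 1ℚ)))) (sym (^ℚ-distrib-* y (y +ℚ 1ℚ) n)) ⟩
  s * ((y * (y +ℚ 1ℚ)) ^ℚ n * (y +ℚ (y +ℚ 1ℚ))) ∎
  where
  K = suc (suc n)
  s = ℕ→ℚ (suc n)
  Y = y ^ℚ n
  Z = (y +ℚ 1ℚ) ^ℚ n
  t : ℕ → ℚ
  t j = ℕ→ℚ (suc n C j) * y ^ℚ j
  split : ∀ j →
    ℕ→ℚ (suc n C j) * (ℕ→ℚ (n + j + 1) * y ^ℚ (n + j)) ≡ Y * (s * t j +ℚ ℕ→ℚ j * t j)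
  split j = begin
    ℕ→ℚ (suc n C j) * (ℕ→ℚ (n + j + 1) * y ^ℚ (n + j))
      ≡⟨ cong₂ (λ u v → ℕ→ℚ (suc n C j) * (u * v))
           (trans (cong ℕ→ℚ (ℕₚ.+-comm (n + j) 1)) (ℕ→ℚ-+ (suc n) j)) (^ℚ-+ y n j) ⟩
    ℕ→ℚ (suc n C j) * ((s +ℚ ℕ→ℚ j) * (Y * y ^ℚ j))
      ≡⟨ solve 5 (λ c s J Y p → c :* ((s :+ J) :* (Y :* p)) := Y :* (s :* (c :* p) :+ J :* (c :* p))) refl
           (ℕ→ℚ (suc n C j)) s (ℕ→ℚ j) Y (y ^ℚ j) ⟩
    Y * (s * t j +ℚ ℕ→ℚ j * t j) ∎

F-odd : ∀ n y → F n (- 1ℚ - y) ≡ - F n y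
F-odd n y = begin
  F n y′                                                         ≡⟨ F-closed n y′ ⟩
  s * ((y′ * (y′ +ℚ 1ℚ)) ^ℚ n * (y′ +ℚ (y′ +ℚ 1ℚ)))
    ≡⟨ cong₂ (λ u v → s * (u ^ℚ n * v))
         (solve 1 (λ y → (con (- 1ℚ) :- y) :* ((con (- 1ℚ) :- y) :+ con 1ℚ)
                          := y :* (y :+ con 1ℚ)) refl y)
         (solve 1 (λ y → (con (- 1ℚ) :- y) :+ ((con (- 1ℚ) :- y) :+ con 1ℚ)
                          := :- (y :+ (y :+ con 1ℚ))) refl y) ⟩
  s * ((y * (y +ℚ 1ℚ)) ^ℚ n * - (y +ℚ (y +ℚ 1ℚ)))
    ≡⟨ solve 3 (λ s u v → s :* (u :* (:- v)) := :- (s :* (u :* v))) refl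
         s ((y * (y +ℚ 1ℚ)) ^ℚ n) (y +ℚ (y +ℚ 1ℚ)) ⟩
  - (s * ((y * (y +ℚ 1ℚ)) ^ℚ n * (y +ℚ (y +ℚ 1ℚ))))            ≡⟨ cong -_ (sym (F-closed n y)) ⟩
  - F n y                                                        ∎
  where
  y′ = - 1ℚ - y
  s = ℕ→ℚ (suc n)

n+j≤n+[n+1] : ∀ n {j} → j < suc (suc n) → n + j ≤ n + suc n
n+j≤n+[n+1] n j<n+2 = ℕₚ.+-monoʳ-≤ n (ℕₚ.≤-pred j<n+2)

F-vanishes : ∀ n → Δ^-vanishes (suc (n + suc n)) (F n)
F-vanishes n = Δ^-vanishes-Σ< M (suc (suc n)) λ j j<n+2 →
  Δ^-vanishes-*ˡ M (ℕ→ℚ (suc n C j)) (Δ^-vanishes-*ˡ M (ℕ→ℚ (n + j + 1))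
    (Δ^-vanishes-≤ (s≤s (n+j≤n+[n+1] n j<n+2)) (^ℚ-vanishes (n + j))))
  where M = suc (n + suc n)

corollary1p5 : (n : ℕ) →
    Σ< (suc (suc n)) (λ j → ℕ→ℚ ((suc n) C j) * (ℕ→ℚ (n + j + 1) * eulerE (n + j) 0ℚ)) ≡ 0ℚ
corollary1p5 n = begin
  Σ< K (λ j → a j * (b j * eulerE (n + j) 0ℚ))
    ≡⟨ Σ<-cong< K (λ j j<K →
         cong (λ e → a j * (b j * e)) (sym (euler-^ℚ N (n + j) (n+j≤n+[n+1] n j<K)))) ⟩
  Σ< K (λ j → a j * (b j * euler N (_^ℚ (n + j)) 0ℚ))
    ≡⟨ Σ<-cong K (λ j → sym (trans (euler-*ˡ N (a j) _ 0ℚ)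
                                    (cong (a j *_) (euler-*ˡ N (b j) (_^ℚ (n + j)) 0ℚ)))) ⟩
  Σ< K (λ j → euler N (λ y → a j * (b j * y ^ℚ (n + j))) 0ℚ)
    ≡⟨ sym (euler-Σ< N K (λ j y → a j * (b j * y ^ℚ (n + j))) 0ℚ) ⟩
  euler N (F n) 0ℚ
    ≡⟨ euler-odd N (F-vanishes n) (F-odd n) ⟩
  0ℚ ∎
  where
  K = suc (suc n)
  N = n + suc n
  a b : ℕ → ℚ
  a j = ℕ→ℚ (suc n C j)
  b j = ℕ→ℚ (n + j + 1)
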